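{- No finite set of moves suffices to connect the sets of maximal chains in all closed intervals of type $A$ crystal posets: there is no integer $d$ such that, for every type $A$ crystal poset $B(\lambda)$ and every closed interval $[u,v]$ in it, any two maximal chains of $[u,v]$ can be connected by a sequence of steps, each replacing the portion of a saturated chain between two of its elements $x<y$ with $\mathrm{rank}(y)-\mathrm{rank}(x)\le d$ by another saturated chain from $x$ to $y$. In particular, there are disconnected open intervals $(u,v)$ in type $A$ crystal posets of arbitrarily large rank.
   Context: A type $A$ crystal poset is the crystal $B(\lambda)$ of the irreducible highest weight $\mathfrak{sl}_n$-module $V(\lambda)$ for a partition $\lambda$ with fewer than $n$ parts, realized as the set of semistandard Young tableaux of shape $\lambda$ with entries in $\{1,\dots,n\}$, partially ordered by the transitive closure of $T\lessdot f_i(T)$, where $f_i$ is the crystal operator given by the signature rule: read the entries $i$ and $i+1$ of $T$ column by column from left to right, bottom to top within a column, write $+$ for $i$ and $-$ for $i+1$, repeatedly cancel adjacent pairs $-+$ to obtain $+^x-^y$; if $x>0$, $f_i(T)$ changes the $i$ corresponding to the rightmost uncancelled $+$ into $i+1$ (otherwise $f_i(T)=\mathbf 0$). The poset is graded; rank means the length of maximal chains. An open interval is disconnected if its Hasse diagram (equivalently its order complex) is disconnected. -}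

module Defs where

open import Data.Nat using (ℕ; zero; suc; _+_; _≤_; _<_; _≡ᵇ_)
open import Data.Nat.Properties using (_≟_)
open import Data.Bool using (Bool; true; false; if_then_else_)
open import Data.List using (List; []; _∷_; _++_; length; map; reverse; concat)
open import Data.List.Relation.Unary.All using (All)
open import Data.List.Relation.Unary.Linked using (Linked)
open import Data.Maybe using (Maybe; just; nothing)
open import Data.Product using (Σ; _×_; _,_; ∃)
open import Data.Empty using (⊥)
open import Relation.Nullary using (¬_)
open import Relation.Binary.PropositionalEquality using (_≡_)
open import Relation.Binary.Construct.Closure.ReflexiveTransitive using (Star)

-- Partitions and semistandard Young tableaux (English convention).
-- A tableau is the list of its rows, top row first; entries are ℕ.

Tableau : Set
Tableau = List (List ℕ)

IsPartition : ℕ → List ℕ → Set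
IsPartition n lam = Linked (λ a b → b ≤ a) lam × All (λ a → 1 ≤ a) lam × length lam < n

data ColStrict : List ℕ → List ℕ → Set where
  cs-nil  : ∀ {r} → ColStrict r []
  cs-cons : ∀ {a b r s} → a < b → ColStrict r s → ColStrict (a ∷ r) (b ∷ s)

IsSSYT : ℕ → List ℕ → Tableau → Set
IsSSYT n lam T =
  map length T ≡ lam
  × All (Linked _≤_) T
  × Linked ColStrict T
  × All (All (λ e → 1 ≤ e × e ≤ n)) T

nth : {A : Set} → List A → ℕ → Maybe A
nth [] _ = nothing
nth (x ∷ xs) zero = just x
nth (x ∷ xs) (suc k) = nth xs k

-- entry at (row r, column c), both 0-based
entry : Tableau → ℕ → ℕ → Maybe ℕ
entry T r c with nth T r
... | nothing = nothing
... | just row = nth row c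

range : ℕ → List ℕ
range zero = []
range (suc k) = range k ++ (k ∷ [])

width : Tableau → ℕ
width [] = 0
width (row ∷ _) = length row

colHeight : Tableau → ℕ → ℕ
colHeight [] c = 0
colHeight (row ∷ T) c with c Data.Nat.<ᵇ length row
... | true = suc (colHeight T c)
... | false = 0

-- reading order: columns left to right, bottom to top within a column
readingPositions : Tableau → List (ℕ × ℕ)
readingPositions T =
  concat (map (λ c → map (λ r → (r , c)) (reverse (range (colHeight T c)))) (range (width T)))

readingWord : Tableau → List ((ℕ × ℕ) × ℕ)
readingWord T = go (readingPositions T)
  where
  go : List (ℕ × ℕ) → List ((ℕ × ℕ) × ℕ)
  go [] = []
  go ((r , c) ∷ ps) with entry T r c
  ... | nothing = go ps
  ... | just e = ((r , c) , e) ∷ go ps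

-- Scan the reading word left to right; i ↦ +, i+1 ↦ −.  Pairs −+ cancel:
-- a + is cancelled iff an earlier still-unmatched − exists.  The state is
-- (number of unmatched −'s, position of the most recent uncancelled +).
signatureScan : ℕ → ℕ → Maybe (ℕ × ℕ) → List ((ℕ × ℕ) × ℕ) → Maybe (ℕ × ℕ)
signatureScan i m best [] = best
signatureScan i m best ((p , e) ∷ w) with e ≡ᵇ i | e ≡ᵇ suc i
... | true | _ with m
...   | zero = signatureScan i zero (just p) w
...   | suc m' = signatureScan i m' best w
signatureScan i m best ((p , e) ∷ w) | false | true = signatureScan i (suc m) best w
signatureScan i m best ((p , e) ∷ w) | false | false = signatureScan i m best w

rightmostFreePlus : ℕ → Tableau → Maybe (ℕ × ℕ)
rightmostFreePlus i T = signatureScan i 0 nothing (readingWord T)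

setNth : {A : Set} → List A → ℕ → (A → A) → List A
setNth [] _ g = []
setNth (x ∷ xs) zero g = g x ∷ xs
setNth (x ∷ xs) (suc k) g = x ∷ setNth xs k g

setEntry : Tableau → ℕ → ℕ → ℕ → Tableau
setEntry T r c v = setNth T r (λ row → setNth row c (λ _ → v))

-- f_i(T); nothing stands for 𝟎
f : ℕ → Tableau → Maybe Tableau
f i T with rightmostFreePlus i T
... | nothing = nothing
... | just (r , c) = just (setEntry T r c (suc i))

Step : ℕ → Tableau → Tableau → Set
Step n T T' = Σ ℕ λ i → 1 ≤ i × suc i ≤ n × f i T ≡ just T'

_≤[_]_ : Tableau → ℕ → Tableau → Set
x ≤[ n ] y = Star (Step n) x y

_<[_]_ : Tableau → ℕ → Tableau → Set
x <[ n ] y = x ≤[ n ] y × ¬ (x ≡ y)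

Cover : ℕ → Tableau → Tableau → Set
Cover n x y = x <[ n ] y × (∀ z → x <[ n ] z → z <[ n ] y → ⊥)

data SatChain (n : ℕ) : Tableau → Tableau → List Tableau → Set where
  sc-one  : ∀ {x} → SatChain n x x (x ∷ [])
  sc-cons : ∀ {x y z c} → Cover n x y → SatChain n y z c → SatChain n x z (x ∷ c)

-- maximal chains of the closed interval [u,v] (a finite poset) are exactly
-- the saturated chains from u to v
MaxChain : ℕ → Tableau → Tableau → List Tableau → Set
MaxChain n u v c = SatChain n u v c

-- One move with parameter d: replace the portion x = x_a, …, x_b = y of a
-- saturated chain, where rank(y) - rank(x) = b - a = length m + 1 ≤ d, by
-- another saturated chain from x to y.
data Move (n d : ℕ) : List Tableau → List Tableau → Set where
  move : ∀ p x m m' y s →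
         suc (length m) ≤ d →
         SatChain n x y ((x ∷ m') ++ (y ∷ [])) →
         Move n d (p ++ (x ∷ m) ++ (y ∷ s)) (p ++ (x ∷ m') ++ (y ∷ s))

-- Take n = d + 3 and λ = (2,2), and write [[p,a],[b,q]] for the tableau with rows (p,a), (b,q).
-- Every crystal edge between such tableaux raises one entry by one, so the entry sum ranks the
-- poset.  For U = [[1,1],[2,n]] and V = [[1,n-1],[n,n]] the interval [U,V] consists of tableaux
-- [[1,a],[b,n]], of rank difference 2d + 2.  The signature rule forbids exactly the edges that
-- would cross the line b = a inside the open interval: f_a kills [[1,a],[a+1,n]], and f_b raises
-- a rather than b on [[1,b],[b,n]].  So b ≤ a is constant on the components of (U,V).  A move of
-- span at most d cannot replace a whole maximal chain, and an interior element it removes is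
-- joined inside (U,V) to a kept endpoint of the replaced segment; hence visiting {b ≤ a} is
-- invariant under moves, which separates a chain through [[1,2],[2,n]] from one through
-- [[1,1],[3,n]].

module Submission where

open import Defs
open import Data.Nat using (ℕ; zero; suc; s≤s; z≤n; _≡ᵇ_; _+_; _≤_; _<_; _≤‴_; ≤‴-reflexive; ≤‴-step)
open import Data.Nat.Tactic.RingSolver using (solve-∀)
import Data.Nat.Properties as ℕ
open import Data.Nat.Properties
  using ( _≟_; ≡ᵇ⇒≡; ≡⇒≡ᵇ; suc-injective; 1+n≢n; +-suc; +-cancelʳ-≡; m≤m+n
        ; ≤-refl; ≤-reflexive; ≤-trans; ≤-pred; n≤1+n; m≤n⇒m≤1+n; m≤n⇒m<n∨m≡n
        ; <⇒≤; <⇒≢; <-irrefl; <-asym; 1+n≰n; m<n⇒m<1+n; ≤⇒≤‴; ≤‴⇒≤ )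
open import Data.Bool using (true; false)
open import Data.Bool.Properties using (T-≡)
open import Data.List using (List; []; _∷_; _++_; [_]; length; map)
open import Data.Nat.ListAction using (sum)
open import Data.List.Relation.Unary.All as All using (All; []; _∷_; lookupAny)
open import Data.List.Relation.Unary.Any using (Any; here; there)
open import Data.List.Relation.Unary.Linked using ([-]; _∷_)
open import Data.List.Relation.Unary.Any.Properties using (++⁺ˡ; ++⁺ʳ) renaming (++⁻ to Any-++⁻)
open import Data.List.Relation.Unary.All.Properties using () renaming (++⁻ˡ to All-++⁻ˡ)
open import Data.List.Properties using (≡-dec; length-++)
open import Data.List.Membership.Propositional using (_∈_)
open import Data.Maybe using (Maybe; just; nothing)
open import Data.Product as Product using (Σ; _×_; _,_; ∃; proj₁; proj₂; uncurry)
open import Data.Sum using (_⊎_; inj₁; inj₂; map₂)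
open import Data.Empty using (⊥; ⊥-elim)
open import Function using (_∘_)
open import Function.Bundles using (Equivalence; _⇔_; mk⇔)
open import Function.Construct.Identity using (⇔-id)
open import Function.Construct.Composition using (_⇔-∘_)
open import Relation.Nullary using (¬_; Dec; yes; no)
open import Relation.Binary.PropositionalEquality
  using (_≡_; _≢_; refl; sym; trans; subst; cong; cong₂; module ≡-Reasoning)
open import Relation.Binary.Construct.Closure.ReflexiveTransitive using (Star; ε; _◅_; _◅◅_)
open ≡-Reasoning

Position : Set
Position = ℕ × ℕ

Word : Set
Word = List (Position × ℕ)

≡ᵇ-refl : ∀ n → (n ≡ᵇ n) ≡ true
≡ᵇ-refl n = Equivalence.to T-≡ (≡⇒≡ᵇ n n refl)

≡ᵇ-false : ∀ {m n} → m ≢ n → (m ≡ᵇ n) ≡ false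
≡ᵇ-false {m} {n} m≢n with m ≡ᵇ n in eq
... | false = refl
... | true  = ⊥-elim (m≢n (≡ᵇ⇒≡ m n (Equivalence.from T-≡ eq)))

data Letter (i : ℕ) : ℕ → Set where
  plus  : Letter i i
  minus : Letter i (suc i)
  other : ∀ {e} → e ≢ i → e ≢ suc i → Letter i e

letter : ∀ i e → Letter i e
letter i e with e ≟ i | e ≟ suc i
... | yes refl | _        = plus
... | no _     | yes refl = minus
... | no e≢i   | no e≢1+i = other e≢i e≢1+i

module _ {i : ℕ} {best : Maybe Position} {p : Position} (w : Word) where

  scan-plus-free : signatureScan i 0 best ((p , i) ∷ w) ≡ signatureScan i 0 (just p) w
  scan-plus-free rewrite ≡ᵇ-refl i = refl

  scan-plus-matched : ∀ {m} → signatureScan i (suc m) best ((p , i) ∷ w) ≡ signatureScan i m best w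
  scan-plus-matched rewrite ≡ᵇ-refl i = refl

  scan-minus : ∀ {m} → signatureScan i m best ((p , suc i) ∷ w) ≡ signatureScan i (suc m) best w
  scan-minus rewrite ≡ᵇ-false (1+n≢n {i}) | ≡ᵇ-refl (suc i) = refl

  scan-other : ∀ {m e} → e ≢ i → e ≢ suc i →
               signatureScan i m best ((p , e) ∷ w) ≡ signatureScan i m best w
  scan-other e≢i e≢1+i rewrite ≡ᵇ-false e≢i | ≡ᵇ-false e≢1+i = refl

signatureScan-sound : ∀ i m best w {p} → signatureScan i m best w ≡ just p →
                      best ≡ just p ⊎ (p , i) ∈ w
signatureScan-sound i m best [] eq = inj₁ eq
signatureScan-sound i m best ((q , e) ∷ w) eq with letter i e
signatureScan-sound i zero best ((q , e) ∷ w) eq | plus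
  with signatureScan-sound i 0 (just q) w (trans (sym (scan-plus-free w)) eq)
... | inj₁ refl = inj₂ (here refl)
... | inj₂ p∈w  = inj₂ (there p∈w)
signatureScan-sound i (suc m) best ((q , e) ∷ w) eq | plus =
  map₂ there (signatureScan-sound i m best w (trans (sym (scan-plus-matched w)) eq))
signatureScan-sound i m best ((q , e) ∷ w) eq | minus =
  map₂ there (signatureScan-sound i (suc m) best w (trans (sym (scan-minus w)) eq))
signatureScan-sound i m best ((q , e) ∷ w) eq | other e≢i e≢1+i =
  map₂ there (signatureScan-sound i m best w (trans (sym (scan-other w e≢i e≢1+i)) eq))

scan-no-plus : ∀ {i m best} w → All (λ l → proj₂ l ≢ i) w → signatureScan i m best w ≡ best
scan-no-plus [] [] = refl
scan-no-plus {i} ((q , e) ∷ w) (e≢i ∷ ns) with letter i e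
... | plus = ⊥-elim (e≢i refl)
... | minus = trans (scan-minus w) (scan-no-plus w ns)
... | other _ e≢1+i = trans (scan-other w e≢i e≢1+i) (scan-no-plus w ns)

scan-last-free : ∀ {i best p} w → All (λ l → proj₂ l ≢ suc i) w →
                 signatureScan i 0 best (w ++ [ (p , i) ]) ≡ just p
scan-last-free {i} [] [] = scan-plus-free {i} []
scan-last-free {i} ((q , e) ∷ w) (e≢1+i ∷ ns) with letter i e
... | plus = trans (scan-plus-free {i} _) (scan-last-free w ns)
... | minus = ⊥-elim (e≢1+i refl)
... | other e≢i _ = trans (scan-other {i} _ e≢i e≢1+i) (scan-last-free w ns)

scan-last-matched : ∀ {i m best p} w → All (λ l → proj₂ l ≢ i) w →
                    signatureScan i (suc m) best (w ++ [ (p , i) ]) ≡ best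
scan-last-matched {i} [] [] = scan-plus-matched {i} []
scan-last-matched {i} ((q , e) ∷ w) (e≢i ∷ ns) with letter i e
... | plus = ⊥-elim (e≢i refl)
... | minus = trans (scan-minus {i} _) (scan-last-matched w ns)
... | other _ e≢1+i = trans (scan-other {i} _ e≢i e≢1+i) (scan-last-matched w ns)

f-free : ∀ {i T r c} → rightmostFreePlus i T ≡ just (r , c) → f i T ≡ just (setEntry T r c (suc i))
f-free {i} {T} eq with rightmostFreePlus i T
f-free refl | just _ = refl

f-none : ∀ {i T} → rightmostFreePlus i T ≡ nothing → f i T ≡ nothing
f-none {i} {T} eq with rightmostFreePlus i T
f-none refl | nothing = refl

f-sound : ∀ {i T T′} → f i T ≡ just T′ →
          ∃ λ ((r , c) : Position) → ((r , c) , i) ∈ readingWord T × setEntry T r c (suc i) ≡ T′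
f-sound {i} {T} eq with rightmostFreePlus i T in found
f-sound {i} {T} refl | just (r , c) with signatureScan-sound i 0 nothing (readingWord T) found
... | inj₂ r,c∈w = (r , c) , r,c∈w , refl

module SaturatedChains (n : ℕ) where

  satChain-≤ : ∀ {x y c} → SatChain n x y c → x ≤[ n ] y
  satChain-≤ sc-one = ε
  satChain-≤ (sc-cons ((x≤w , _) , _) rest) = x≤w ◅◅ satChain-≤ rest

  satChain-between : ∀ {x y c} → SatChain n x y c → All (λ z → x ≤[ n ] z × z ≤[ n ] y) c
  satChain-between sc-one = (ε , ε) ∷ []
  satChain-between chain@(sc-cons ((x≤w , _) , _) rest) =
    (ε , satChain-≤ chain) ∷ All.map (Product.map₁ (x≤w ◅◅_)) (satChain-between rest)

  satChain-split : ∀ c₁ {x y w c₂} → SatChain n x y (c₁ ++ w ∷ c₂) →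
                   SatChain n x w (c₁ ++ [ w ]) × SatChain n w y (w ∷ c₂)
  satChain-split [] sc-one = sc-one , sc-one
  satChain-split [] chain@(sc-cons _ _) = sc-one , chain
  satChain-split (_ ∷ []) (sc-cons cover rest) = Product.map₁ (sc-cons cover) (satChain-split [] rest)
  satChain-split (_ ∷ c₁@(_ ∷ _)) (sc-cons cover rest) =
    Product.map₁ (sc-cons cover) (satChain-split c₁ rest)

  satChain-join : ∀ c₁ {x y w c₂} → SatChain n x w (c₁ ++ [ w ]) → SatChain n w y (w ∷ c₂) →
                  SatChain n x y (c₁ ++ w ∷ c₂)
  satChain-join [] sc-one chain = chain
  satChain-join (_ ∷ []) (sc-cons cover rest) chain = sc-cons cover (satChain-join [] rest chain)
  satChain-join (_ ∷ c₁@(_ ∷ _)) (sc-cons cover rest) chain =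
    sc-cons cover (satChain-join c₁ rest chain)

  satChain-head : ∀ {P : Tableau → Set} {x y c} → P x → SatChain n x y c → Any P c
  satChain-head px sc-one = here px
  satChain-head px (sc-cons _ _) = here px

  Chain : Tableau → Tableau → Set
  Chain x y = ∃ (SatChain n x y)

  infixr 5 _⁀_

  _⁀_ : ∀ {x w y} → Chain x w → Chain w y → Chain x y
  (_ , sc-one) ⁀ chain = chain
  (_ , sc-cons cover rest) ⁀ chain = Product.map (_ ∷_) (sc-cons cover) ((_ , rest) ⁀ chain)

module Graded (n : ℕ) {D : Tableau → Set}
              (D-step : ∀ {x y} → D x → Step n x y → D y)
              (rank : Tableau → ℕ)
              (rank-step : ∀ {x y} → D x → Step n x y → rank y ≡ suc (rank x)) where

  open SaturatedChains n

  D-star : ∀ {x y} → D x → x ≤[ n ] y → D y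
  D-star dx ε = dx
  D-star dx (s ◅ rest) = D-star (D-step dx s) rest

  star-rank : ∀ {x y} → D x → x ≤[ n ] y → x ≡ y ⊎ rank x < rank y
  star-rank dx ε = inj₁ refl
  star-rank dx (s ◅ rest) with star-rank (D-step dx s) rest
  ... | inj₁ refl = inj₂ (≤-reflexive (sym (rank-step dx s)))
  ... | inj₂ lt = inj₂ (≤-trans (≤-reflexive (sym (rank-step dx s))) (<⇒≤ lt))

  <⇒rank< : ∀ {x y} → D x → x <[ n ] y → rank x < rank y
  <⇒rank< dx (x≤y , x≢y) with star-rank dx x≤y
  ... | inj₁ x≡y = ⊥-elim (x≢y x≡y)
  ... | inj₂ lt = lt

  ≤-antisym : ∀ {x y} → D x → x ≤[ n ] y → y ≤[ n ] x → x ≡ y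
  ≤-antisym dx x≤y y≤x with star-rank dx x≤y | star-rank (D-star dx x≤y) y≤x
  ... | inj₁ x≡y | _        = x≡y
  ... | inj₂ _   | inj₁ y≡x = sym y≡x
  ... | inj₂ lt  | inj₂ gt  = ⊥-elim (<-asym lt gt)

  step⇒cover : ∀ {x y} → D x → Step n x y → Cover n x y
  step⇒cover {x} {y} dx s = (s ◅ ε , x≢y) , no-middle
    where
    x≢y : x ≢ y
    x≢y refl = 1+n≢n (sym (rank-step dx s))
    no-middle : ∀ z → x <[ n ] z → z <[ n ] y → ⊥
    no-middle z x<z z<y = <-irrefl refl (≤-trans (<⇒rank< (D-star dx (proj₁ x<z)) z<y)
                                                 (≤-trans (≤-reflexive (rank-step dx s)) (<⇒rank< dx x<z)))

  cover⇒rank : ∀ {x y} → D x → Cover n x y → rank y ≡ suc (rank x)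
  cover⇒rank dx ((ε , x≢x) , _) = ⊥-elim (x≢x refl)
  cover⇒rank dx ((s ◅ rest , _) , no-middle) with star-rank (D-step dx s) rest
  ... | inj₁ refl = rank-step dx s
  ... | inj₂ lt =
    ⊥-elim (no-middle _ (proj₁ (step⇒cover dx s)) (rest , λ w≡y → <-irrefl (cong rank w≡y) lt))

  satChain-length : ∀ {x y c} → D x → SatChain n x y c → length c + rank x ≡ suc (rank y)
  satChain-length dx sc-one = refl
  satChain-length {x} {y} dx (sc-cons {y = w} {c = c} cover rest) = begin
    suc (length c + rank x)  ≡⟨ sym (+-suc (length c) (rank x)) ⟩
    length c + suc (rank x)  ≡⟨ cong (length c +_) (sym (cover⇒rank dx cover)) ⟩
    length c + rank w        ≡⟨ satChain-length (D-star dx (proj₁ (proj₁ cover))) rest ⟩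
    suc (rank y)             ∎

  step-cons : ∀ {x w y} → D x → Step n x w → Chain w y → Chain x y
  step-cons dx s chain = (_ , sc-cons (step⇒cover dx s) sc-one) ⁀ chain

  ladder : (g : ℕ → Tableau) → ∀ {k l} → D (g k) → k ≤‴ l →
           (∀ {j} → k ≤ j → j < l → Step n (g j) (g (suc j))) → Chain (g k) (g l)
  ladder g dgk (≤‴-reflexive refl) steps = _ , sc-one
  ladder g dgk (≤‴-step k<l) steps =
    step-cons dgk s (ladder g (D-step dgk s) k<l (λ k<j j<l → steps (<⇒≤ k<j) j<l))
    where s = steps ≤-refl (≤‴⇒≤ k<l)

_≟ᵀ_ : (x y : Tableau) → Dec (x ≡ y)
_≟ᵀ_ = ≡-dec (≡-dec _≟_)

module Separation (n d : ℕ) (u v : Tableau)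
                  (≤-antisym-above : ∀ {x y} → u ≤[ n ] x → x ≤[ n ] y → y ≤[ n ] x → x ≡ y) where

  open SaturatedChains n

  Inside : Tableau → Set
  Inside z = u <[ n ] z × z <[ n ] v

  u≢-above : ∀ {x w} → Inside x → x ≤[ n ] w → u ≢ w
  u≢-above ((u≤x , u≢x) , _) x≤u refl = u≢x (≤-antisym-above ε u≤x x≤u)

  ≢v-below : ∀ {z w} → Inside z → w ≤[ n ] z → w ≢ v
  ≢v-below ((u≤z , _) , (z≤v , z≢v)) v≤z refl = z≢v (≤-antisym-above u≤z z≤v v≤z)

  inside-between : ∀ {x w z} → Inside x → Inside z → x ≤[ n ] w → w ≤[ n ] z → Inside w
  inside-between ix@((u≤x , _) , _) iz@(_ , (z≤v , _)) x≤w w≤z =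
    (u≤x ◅◅ x≤w , u≢-above ix x≤w) , (w≤z ◅◅ z≤v , ≢v-below iz w≤z)

  module _ {P : Tableau → Set}
           (P-step : ∀ {x y} → Inside x → Inside y → Step n x y → P x ⇔ P y) where

    P-along : ∀ {x z} → Inside x → Inside z → x ≤[ n ] z → P x ⇔ P z
    P-along ix iz ε = ⇔-id _
    P-along ix iz (s ◅ rest) = P-along iw iz rest ⇔-∘ P-step ix iw s
      where iw = inside-between ix iz (s ◅ ε) rest

    Visits : List Tableau → Set
    Visits = Any (λ z → Inside z × P z)

    escape : ∀ {x y z} → Inside z → P z → x ≤[ n ] z → z ≤[ n ] y → u ≤[ n ] x → y ≤[ n ] v →
             (Inside x × P x) ⊎ (Inside y × P y) ⊎ (x ≡ u × y ≡ v)
    escape {x} {y} iz pz x≤z z≤y u≤x y≤v with x ≟ᵀ u | y ≟ᵀ v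
    ... | no x≢u | _ = inj₁ (ix , Equivalence.from (P-along ix iz x≤z) pz)
      where ix = (u≤x , x≢u ∘ sym) , (x≤z ◅◅ proj₁ (proj₂ iz) , ≢v-below iz x≤z)
    ... | yes refl | no y≢v = inj₂ (inj₁ (iy , Equivalence.to (P-along iz iy z≤y) pz))
      where iy = (x≤z ◅◅ z≤y , u≢-above iz z≤y) , (y≤v , y≢v)
    ... | yes x≡u | yes y≡v = inj₂ (inj₂ (x≡u , y≡v))

    unvisited : ∀ {w c} → Inside w → ¬ P w → SatChain n w v c → ¬ Visits (u ∷ c)
    unvisited iw ¬pw chain (here (((_ , u≢u) , _) , _)) = u≢u refl
    unvisited iw ¬pw chain (there in-c) with lookupAny (satChain-between chain) in-c
    ... | (w≤z , _) , (iz , pz) = ¬pw (Equivalence.from (P-along iw iz w≤z) pz)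

    module _ (long : ∀ {m} → SatChain n u v (u ∷ m ++ [ v ]) → d ≤ length m) where

      move-preserves : ∀ {c c′} → Move n d c c′ → SatChain n u v c → Visits c →
                       SatChain n u v c′ × Visits c′
      move-preserves (move p x m m′ y s short new) chain visit with satChain-split p chain
      ... | to-x , from-x with satChain-split (x ∷ m) from-x
      ... | old , from-y =
        satChain-join p to-x (satChain-join (x ∷ m′) new from-y) , revisit (Any-++⁻ p visit)
        where
        revisit : Visits p ⊎ Visits ((x ∷ m) ++ y ∷ s) → Visits (p ++ (x ∷ m′) ++ y ∷ s)
        revisit (inj₁ in-p) = ++⁺ˡ in-p
        revisit (inj₂ (here at-x)) = ++⁺ʳ p (here at-x)
        revisit (inj₂ (there after-x)) with Any-++⁻ m after-x
        ... | inj₂ in-ys = ++⁺ʳ p (there (++⁺ʳ m′ in-ys))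
        ... | inj₁ in-m with lookupAny (All-++⁻ˡ m (All.tail (satChain-between old))) in-m
        ...   | (x≤z , z≤y) , (iz , pz) with escape iz pz x≤z z≤y (satChain-≤ to-x) (satChain-≤ from-y)
        ...     | inj₁ at-x = ++⁺ʳ p (here at-x)
        ...     | inj₂ (inj₁ at-y) = ++⁺ʳ p (there (++⁺ʳ m′ (here at-y)))
        ...     | inj₂ (inj₂ (refl , refl)) = ⊥-elim (<-irrefl refl (≤-trans short (long old)))

      moves-preserve : ∀ {c c′} → Star (Move n d) c c′ → SatChain n u v c → Visits c → Visits c′
      moves-preserve ε chain visit = visit
      moves-preserve (mv ◅ mvs) chain visit = uncurry (moves-preserve mvs) (move-preserves mv chain visit)

      not-move-connected : ∀ {c c′} → SatChain n u v c → Visits c → ¬ Visits c′ → ¬ Star (Move n d) c c′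
      not-move-connected chain visit ¬visit′ mvs = ¬visit′ (moves-preserve mvs chain visit)

sq : ℕ → ℕ → ℕ → ℕ → Tableau
sq p a b q = (p ∷ a ∷ []) ∷ (b ∷ q ∷ []) ∷ []

data Square : Tableau → Set where
  square : ∀ p a b q → Square (sq p a b q)

data Raise (i : ℕ) : Tableau → Tableau → Set where
  raise-p : ∀ {a b q} → Raise i (sq i a b q) (sq (suc i) a b q)
  raise-a : ∀ {p b q} → Raise i (sq p i b q) (sq p (suc i) b q)
  raise-b : ∀ {p a q} → Raise i (sq p a i q) (sq p a (suc i) q)
  raise-q : ∀ {p a b} → Raise i (sq p a b i) (sq p a b (suc i))

-- The reading word of sq p a b q is b p q a; the words in the lemmas on f below are this one.
f-sq : ∀ {i p a b q y} → f i (sq p a b q) ≡ just y → Raise i (sq p a b q) y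
f-sq eq with f-sound eq
... | _ , here refl , refl = raise-b
... | _ , there (here refl) , refl = raise-p
... | _ , there (there (here refl)) , refl = raise-q
... | _ , there (there (there (here refl))) , refl = raise-a

f-raise-a : ∀ {p a b q} → b ≢ suc a → p ≢ suc a → q ≢ suc a →
            f a (sq p a b q) ≡ just (sq p (suc a) b q)
f-raise-a {p} {a} {b} {q} b≢ p≢ q≢ =
  f-free (scan-last-free {a} (((1 , 0) , b) ∷ ((0 , 0) , p) ∷ ((1 , 1) , q) ∷ []) (b≢ ∷ p≢ ∷ q≢ ∷ []))

f-raise-b : ∀ {p a b q} → p ≢ b → q ≢ b → a ≢ b → f b (sq p a b q) ≡ just (sq p a (suc b) q)
f-raise-b {p} {a} {b} {q} p≢ q≢ a≢ =
  f-free (trans (scan-plus-free {b} rest) (scan-no-plus rest (p≢ ∷ q≢ ∷ a≢ ∷ [])))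
  where rest = ((0 , 0) , p) ∷ ((1 , 1) , q) ∷ ((0 , 1) , a) ∷ []

f-raise-b-diagonal : ∀ {p b} → p ≢ b → p ≢ suc b →
                     f b (sq p b b (suc b)) ≡ just (sq p b (suc b) (suc b))
f-raise-b-diagonal {p} {b} p≢b p≢1+b = f-free (begin
  signatureScan b 0 nothing (((1 , 0) , b) ∷ ((0 , 0) , p) ∷ ((1 , 1) , suc b) ∷ ((0 , 1) , b) ∷ [])
    ≡⟨ scan-plus-free {b} _ ⟩
  signatureScan b 0 (just (1 , 0)) (((0 , 0) , p) ∷ ((1 , 1) , suc b) ∷ ((0 , 1) , b) ∷ [])
    ≡⟨ scan-other {b} _ p≢b p≢1+b ⟩
  signatureScan b 0 (just (1 , 0)) (((1 , 1) , suc b) ∷ ((0 , 1) , b) ∷ [])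
    ≡⟨ scan-minus {b} _ ⟩
  signatureScan b 1 (just (1 , 0)) (((0 , 1) , b) ∷ [])
    ≡⟨ scan-plus-matched {b} [] ⟩
  just (1 , 0) ∎)

f-blocked : ∀ {p i q} → p ≢ i → q ≢ i → f i (sq p i (suc i) q) ≡ nothing
f-blocked {p} {i} {q} p≢ q≢ =
  f-none (trans (scan-minus {i} _)
                (scan-last-matched (((0 , 0) , p) ∷ ((1 , 1) , q) ∷ []) (p≢ ∷ q≢ ∷ [])))

data _≼_ : Tableau → Tableau → Set where
  ≼-sq : ∀ {p a b q p′ a′ b′ q′} → p ≤ p′ → a ≤ a′ → b ≤ b′ → q ≤ q′ → sq p a b q ≼ sq p′ a′ b′ q′

≼-refl : ∀ {x} → Square x → x ≼ x
≼-refl (square _ _ _ _) = ≼-sq ≤-refl ≤-refl ≤-refl ≤-refl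

≼-trans : ∀ {x y z} → x ≼ y → y ≼ z → x ≼ z
≼-trans (≼-sq p≤ a≤ b≤ q≤) (≼-sq p≤′ a≤′ b≤′ q≤′) =
  ≼-sq (≤-trans p≤ p≤′) (≤-trans a≤ a≤′) (≤-trans b≤ b≤′) (≤-trans q≤ q≤′)

raise-≼ : ∀ {i x y} → Raise i x y → x ≼ y
raise-≼ raise-p = ≼-sq (n≤1+n _) ≤-refl ≤-refl ≤-refl
raise-≼ raise-a = ≼-sq ≤-refl (n≤1+n _) ≤-refl ≤-refl
raise-≼ raise-b = ≼-sq ≤-refl ≤-refl (n≤1+n _) ≤-refl
raise-≼ raise-q = ≼-sq ≤-refl ≤-refl ≤-refl (n≤1+n _)

raise-square : ∀ {i x y} → Raise i x y → Square y
raise-square raise-p = square _ _ _ _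
raise-square raise-a = square _ _ _ _
raise-square raise-b = square _ _ _ _
raise-square raise-q = square _ _ _ _

entrySum : Tableau → ℕ
entrySum = sum ∘ map sum

entrySum-sq : ∀ p a b q → entrySum (sq p a b q) ≡ p + a + b + q
entrySum-sq = normalise
  where
  normalise : ∀ p a b q → p + (a + 0) + (b + (q + 0) + 0) ≡ p + a + b + q
  normalise = solve-∀

raise-entrySum : ∀ {i x y} → Raise i x y → entrySum y ≡ suc (entrySum x)
raise-entrySum {i} (raise-p {a} {b} {q}) = refl
raise-entrySum {i} (raise-a {p} {b} {q}) = cong (_+ (b + (q + 0) + 0)) (+-suc p (i + 0))
raise-entrySum {i} (raise-b {p} {a} {q}) = +-suc (p + (a + 0)) (i + (q + 0) + 0)
raise-entrySum {i} (raise-q {p} {a} {b}) = trans (cong (λ t → p + (a + 0) + (t + 0)) (+-suc b (i + 0)))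
                                                 (+-suc (p + (a + 0)) (b + (i + 0) + 0))

module _ {n : ℕ} where

  step-raise : ∀ {x y} → Square x → Step n x y → ∃ λ i → Raise i x y
  step-raise (square _ _ _ _) (i , _ , _ , fx≡y) = i , f-sq fx≡y

  square-step : ∀ {x y} → Square x → Step n x y → Square y
  square-step sx s = raise-square (proj₂ (step-raise sx s))

  entrySum-step : ∀ {x y} → Square x → Step n x y → entrySum y ≡ suc (entrySum x)
  entrySum-step sx s = raise-entrySum (proj₂ (step-raise sx s))

  star-≼ : ∀ {x y} → Square x → x ≤[ n ] y → x ≼ y
  star-≼ sx ε = ≼-refl sx
  star-≼ sx (s ◅ rest) = ≼-trans (raise-≼ (proj₂ (step-raise sx s))) (star-≼ (square-step sx s) rest)

sq-ssyt : ∀ {n p a b q} → 1 ≤ p → p ≤ a → b ≤ q → p < b → a < q → q ≤ n →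
          IsSSYT n (2 ∷ 2 ∷ []) (sq p a b q)
sq-ssyt 1≤p p≤a b≤q p<b a<q q≤n =
  refl ,
  (p≤a ∷ [-]) ∷ (b≤q ∷ [-]) ∷ [] ,
  cs-cons p<b (cs-cons a<q cs-nil) ∷ [-] ,
  ((1≤p , p≤n) ∷ (≤-trans 1≤p p≤a , a≤n) ∷ []) ∷
  ((1≤b , b≤n) ∷ (≤-trans 1≤b b≤q , q≤n) ∷ []) ∷ []
  where
  a≤n = ≤-trans (<⇒≤ a<q) q≤n
  b≤n = ≤-trans b≤q q≤n
  p≤n = ≤-trans p≤a a≤n
  1≤b = ≤-trans 1≤p (<⇒≤ p<b)

data SW≤NE : Tableau → Set where
  sw≤ne : ∀ {p a b q} → b ≤ a → SW≤NE (sq p a b q)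

module Counterexample (d : ℕ) where

  M N : ℕ
  M = 2 + d
  N = suc M

  U V : Tableau
  U = sq 1 1 2 N
  V = sq 1 M N N

  open SaturatedChains N
  open Graded N square-step entrySum entrySum-step
  open Separation N d U V (λ U≤x → ≤-antisym (D-star (square 1 1 2 N) U≤x))

  data Box : Tableau → Set where
    box : ∀ {a b} → 1 ≤ a → a ≤ M → 2 ≤ b → b ≤ N → Box (sq 1 a b N)

  interval⊆box : ∀ {z} → U ≤[ N ] z → z ≤[ N ] V → Box z
  interval⊆box U≤z z≤V with star-≼ (square 1 1 2 N) U≤z
  ... | ≼-sq {p′ = p} {a′ = a} {b′ = b} {q′ = q} 1≤p 1≤a 2≤b N≤q with star-≼ (square p a b q) z≤V
  ... | ≼-sq p≤1 a≤M b≤N q≤N with ℕ.≤-antisym p≤1 1≤p | ℕ.≤-antisym q≤N N≤q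
  ... | refl | refl = box 1≤a a≤M 2≤b b≤N

  inside⊆box : ∀ {z} → Inside z → Box z
  inside⊆box ((U≤z , _) , (z≤V , _)) = interval⊆box U≤z z≤V

  raise-a-reflects-sw≤ne : ∀ {a b} → sq 1 a b N ≢ U → a ≤ M →
                           f a (sq 1 a b N) ≡ just (sq 1 (suc a) b N) → b ≤ suc a → b ≤ a
  raise-a-reflects-sw≤ne {a} x≢U a≤M fx≡y b≤1+a with m≤n⇒m<n∨m≡n b≤1+a
  ... | inj₁ b<1+a = ≤-pred b<1+a
  ... | inj₂ refl = ⊥-elim (impossible (trans (sym (f-blocked 1≢a N≢a)) fx≡y))
    where
    1≢a : 1 ≢ a
    1≢a 1≡a = x≢U (cong (λ t → sq 1 t (suc t) N) (sym 1≡a))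
    N≢a : N ≢ a
    N≢a N≡a = 1+n≰n (subst (_≤ M) (sym N≡a) a≤M)
    impossible : ∀ {T : Tableau} → nothing ≢ just T
    impossible ()

  raise-b-preserves-sw≤ne : ∀ {a b} → 2 ≤ b → sq 1 a (suc b) N ≢ V →
                            f b (sq 1 a b N) ≡ just (sq 1 a (suc b) N) → b ≤ a → b < a
  raise-b-preserves-sw≤ne {b = b} 2≤b y≢V fx≡y b≤a with m≤n⇒m<n∨m≡n b≤a
  ... | inj₁ b<a = b<a
  ... | inj₂ refl = ⊥-elim (impossible (trans (sym (f-raise-a (1+n≢n ∘ sym) 1≢1+b N≢1+b)) fx≡y))
    where
    1≢1+b : 1 ≢ suc b
    1≢1+b = <⇒≢ (s≤s (≤-trans (n≤1+n 1) 2≤b))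
    N≢1+b : N ≢ suc b
    N≢1+b N≡1+b = y≢V (cong₂ (λ s t → sq 1 s t N) (sym (suc-injective N≡1+b)) (sym N≡1+b))
    impossible : just (sq 1 (suc b) b N) ≢ just (sq 1 b (suc b) N)
    impossible ()

  sw≤ne-step : ∀ {x y} → Inside x → Inside y → Step N x y → SW≤NE x ⇔ SW≤NE y
  sw≤ne-step ix@((_ , U≢x) , _) iy@(_ , (_ , y≢V)) (i , _ , _ , fx≡y) with inside⊆box ix
  ... | box _ a≤M 2≤b _ with f-sq fx≡y | inside⊆box iy
  ...   | raise-a | _ =
    mk⇔ (λ { (sw≤ne b≤a) → sw≤ne (m≤n⇒m≤1+n b≤a) })
        (λ { (sw≤ne b≤1+a) → sw≤ne (raise-a-reflects-sw≤ne (U≢x ∘ sym) a≤M fx≡y b≤1+a) })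
  ...   | raise-b | _ =
    mk⇔ (λ { (sw≤ne b≤a) → sw≤ne (raise-b-preserves-sw≤ne 2≤b y≢V fx≡y b≤a) })
        (λ { (sw≤ne b<a) → sw≤ne (<⇒≤ b<a) })
  ...   | raise-p | ()
  ...   | raise-q | ()

  raise-a-step : ∀ {a b} → 1 ≤ a → a < M → b ≢ suc a → Step N (sq 1 a b N) (sq 1 (suc a) b N)
  raise-a-step 1≤a a<M b≢1+a =
    _ , 1≤a , m≤n⇒m≤1+n a<M , f-raise-a b≢1+a (<⇒≢ (s≤s 1≤a)) (<⇒≢ (s≤s a<M) ∘ sym)

  raise-b-step : ∀ {a b} → 2 ≤ b → b < N → a ≢ b → Step N (sq 1 a b N) (sq 1 a (suc b) N)
  raise-b-step 2≤b b<N a≢b =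
    _ , ≤-trans (n≤1+n 1) 2≤b , b<N , f-raise-b (<⇒≢ 2≤b) (<⇒≢ b<N ∘ sym) a≢b

  2≤M : 2 ≤ M
  2≤M = s≤s (s≤s z≤n)

  chainA′ : Chain (sq 1 2 2 N) V
  chainA′ =
    ladder (λ a → sq 1 a 2 N) (square 1 2 2 N) (≤⇒≤‴ 2≤M)
      (λ 2≤a a<M → raise-a-step (≤-trans (n≤1+n 1) 2≤a) a<M (<⇒≢ (s≤s 2≤a)))
    ⁀ ladder (λ b → sq 1 M b N) (square 1 M 2 N) (≤⇒≤‴ 2≤M)
        (λ 2≤b b<M → raise-b-step 2≤b (m<n⇒m<1+n b<M) (<⇒≢ b<M ∘ sym))
    ⁀ step-cons (square 1 M M N) (M , ≤-trans (n≤1+n 1) 2≤M , ≤-refl , f-raise-b-diagonal (λ ()) (λ ()))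
        (_ , sc-one)

  chainB′ : Chain (sq 1 1 3 N) V
  chainB′ =
    ladder (λ b → sq 1 1 b N) (square 1 1 3 N) (≤⇒≤‴ (s≤s 2≤M))
      (λ 3≤b b<N → raise-b-step (≤-trans (n≤1+n 2) 3≤b) b<N (<⇒≢ (≤-trans (n≤1+n 2) 3≤b)))
    ⁀ ladder (λ a → sq 1 a N N) (square 1 1 N N) (≤⇒≤‴ (≤-trans (n≤1+n 1) 2≤M))
        (λ 1≤a a<M → raise-a-step 1≤a a<M (<⇒≢ (s≤s a<M) ∘ sym))

  U⋖22 : Step N U (sq 1 2 2 N)
  U⋖22 = 1 , ≤-refl , m≤n⇒m≤1+n 2≤M , refl

  U⋖13 : Step N U (sq 1 1 3 N)
  U⋖13 = raise-b-step ≤-refl (s≤s 2≤M) (λ ())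

  chainA chainB : Chain U V
  chainA = step-cons (square 1 1 2 N) U⋖22 chainA′
  chainB = step-cons (square 1 1 2 N) U⋖13 chainB′

  visitsA : Visits sw≤ne-step (proj₁ chainA)
  visitsA = there (satChain-head (inside-22 , sw≤ne ≤-refl) (proj₂ chainA′))
    where
    inside-22 : Inside (sq 1 2 2 N)
    inside-22 = (U⋖22 ◅ ε , λ ()) , (satChain-≤ (proj₂ chainA′) , λ ())

  ¬visitsB : ¬ Visits sw≤ne-step (proj₁ chainB)
  ¬visitsB = unvisited sw≤ne-step inside-13 (λ { (sw≤ne (s≤s ())) }) (proj₂ chainB′)
    where
    inside-13 : Inside (sq 1 1 3 N)
    inside-13 = (U⋖13 ◅ ε , λ ()) , (satChain-≤ (proj₂ chainB′) , λ ())

  -- entrySum V − entrySum U = 2d + 2, so a maximal chain of [U, V] has 2d + 1 interior elements.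
  maxChain-long : ∀ {m} → SatChain N U V (U ∷ m ++ [ V ]) → d ≤ length m
  maxChain-long {m} chain = subst (d ≤_) (sym length-m) (m≤m+n d (suc d))
    where
    arithˡ : ∀ k e → k + (9 + e) ≡ suc (k + 1) + (1 + 1 + 2 + (3 + e))
    arithˡ = solve-∀
    arithʳ : ∀ e → suc (1 + (2 + e) + (3 + e) + (3 + e)) ≡ e + suc e + (9 + e)
    arithʳ = solve-∀
    length-m : length m ≡ d + suc d
    length-m = +-cancelʳ-≡ (9 + d) (length m) (d + suc d) (begin
      length m + (9 + d)                     ≡⟨ arithˡ (length m) d ⟩
      suc (length m + 1) + (1 + 1 + 2 + N)
        ≡⟨ cong₂ (λ ℓ e → suc ℓ + e) (sym (length-++ m)) (sym (entrySum-sq 1 1 2 N)) ⟩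
      length (U ∷ m ++ [ V ]) + entrySum U   ≡⟨ satChain-length (square 1 1 2 N) chain ⟩
      suc (entrySum V)                       ≡⟨ cong suc (entrySum-sq 1 M N N) ⟩
      suc (1 + M + N + N)                    ≡⟨ arithʳ d ⟩
      d + suc d + (9 + d)                    ∎)

  two-by-two : IsPartition N (2 ∷ 2 ∷ [])
  two-by-two = (≤-refl ∷ [-]) , (s≤s z≤n ∷ s≤s z≤n ∷ []) , s≤s (s≤s (s≤s z≤n))

  U-ssyt : IsSSYT N (2 ∷ 2 ∷ []) U
  U-ssyt = sq-ssyt ≤-refl ≤-refl (m≤n⇒m≤1+n 2≤M) ≤-refl (s≤s (s≤s z≤n)) ≤-refl

  V-ssyt : IsSSYT N (2 ∷ 2 ∷ []) V
  V-ssyt = sq-ssyt ≤-refl (≤-trans (n≤1+n 1) 2≤M) ≤-refl (s≤s (s≤s z≤n)) ≤-refl ≤-refl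

  chainA↮chainB : ¬ Star (Move N d) (proj₁ chainA) (proj₁ chainB)
  chainA↮chainB = not-move-connected sw≤ne-step maxChain-long (proj₂ chainA) visitsA ¬visitsB

theorem7p1 : ¬ (Σ ℕ λ d → ∀ (n : ℕ) (lam : List ℕ) → IsPartition n lam →
               ∀ (u v : Tableau) → IsSSYT n lam u → IsSSYT n lam v →
               ∀ (c c' : List Tableau) → MaxChain n u v c → MaxChain n u v c' →
               Star (Move n d) c c')
theorem7p1 (d , connected) =
  chainA↮chainB
    (connected N (2 ∷ 2 ∷ []) two-by-two U V U-ssyt V-ssyt _ _ (proj₂ chainA) (proj₂ chainB))
  where open Counterexample d
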